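{- $(5,6)\in\mathrm{HWP}(24;3,4)$; that is, $K_{24}$ minus a 1-factor has a 2-factorization consisting of exactly $5$ $C_3$-factors and $6$ $C_4$-factors.
   Context: A $C_k$-factor of a graph is a spanning subgraph all of whose components are cycles of length $k$. A 2-factorization is a partition of the edge set into 2-factors. $\mathrm{HWP}(v;m,n)$ is the set of pairs $(\alpha,\beta)$ such that $K_v$ ($v$ odd) or $K_v$ minus a 1-factor ($v$ even) has a 2-factorization into exactly $\alpha$ $C_m$-factors and $\beta$ $C_n$-factors. -}

module Defs where

open import Data.Nat using (ℕ; zero; suc; _+_; _∸_; _%_; _≤_)
open import Data.Nat.DivMod using (m%n<n)
open import Data.Fin using (Fin; toℕ; fromℕ<)
open import Data.Vec using (Vec; lookup; toList)
open import Data.List using (List; concatMap; allFin; _∷_; [])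
open import Data.List.Membership.Propositional using (_∈_)
open import Data.List.Relation.Binary.Permutation.Propositional using (_↭_)
open import Data.Product using (Σ; _×_; _,_; ∃; ∃-syntax)
open import Data.Sum using (_⊎_; inj₁; inj₂)
open import Relation.Binary.PropositionalEquality using (_≡_; _≢_)
open import Relation.Nullary using (¬_)

Graph : ℕ → Set₁
Graph v = Fin v → Fin v → Set

next : ∀ {k} → Fin (suc k) → Fin (suc k)
next {k} i = fromℕ< (m%n<n (suc (toℕ i)) (suc k))

-- A cycle of length suc k: a cyclic sequence of vertices c₀ c₁ … c_k
-- (distinctness of its vertices is enforced by the factor condition below).
Cycle : ℕ → ℕ → Set
Cycle v k = Vec (Fin v) (suc k)

CycleEdge : ∀ {v k} → Cycle v k → Fin v → Fin v → Set
CycleEdge c x y =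
  ∃[ i ] ((lookup c i ≡ x × lookup c (next i) ≡ y) ⊎
          (lookup c i ≡ y × lookup c (next i) ≡ x))

-- A C_k-factor of a graph on Fin v (here k = suc k'): a list of k-cycles whose
-- vertex sequences together form a permutation of all vertices (so the
-- cycles are vertex-disjoint, each has distinct vertices, and they span).
record CFactor (v k : ℕ) : Set where
  field
    cycles   : List (Cycle v k)
    spanning : concatMap toList cycles ↭ allFin v

FactorEdge : ∀ {v k} → CFactor v k → Fin v → Fin v → Set
FactorEdge F x y = ∃[ c ] (c ∈ CFactor.cycles F × CycleEdge c x y)

record OneFactor (v : ℕ) : Set where
  field
    pairs    : List (Fin v × Fin v)
    spanning : concatMap (λ { (a , b) → a ∷ b ∷ [] }) pairs ↭ allFin v

Matched : ∀ {v} → OneFactor v → Fin v → Fin v → Set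
Matched M x y = ((x , y) ∈ OneFactor.pairs M) ⊎ ((y , x) ∈ OneFactor.pairs M)

K : (v : ℕ) → Graph v
K v x y = x ≢ y

KminusF : ∀ {v} → OneFactor v → Graph v
KminusF M x y = x ≢ y × ¬ Matched M x y

EdgeOf : ∀ {v m' n' α β} → (Fin α → CFactor v m') → (Fin β → CFactor v n') →
         Fin α ⊎ Fin β → Fin v → Fin v → Set
EdgeOf A B (inj₁ i) = FactorEdge (A i)
EdgeOf A B (inj₂ j) = FactorEdge (B j)

record TwoFactorization {v : ℕ} (G : Graph v) (m' n' α β : ℕ) : Set where
  field
    mFactors : Fin α → CFactor v m'
    nFactors : Fin β → CFactor v n'
    sound    : ∀ f x y → EdgeOf mFactors nFactors f x y → G x y
    covering : ∀ x y → G x y → ∃[ f ] EdgeOf mFactors nFactors f x y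
    unique   : ∀ f g x y → EdgeOf mFactors nFactors f x y →
               EdgeOf mFactors nFactors g x y → f ≡ g

-- (α , β) ∈ HWP(v; m, n), for cycle lengths m, n ≥ 3 (cycles are stored
-- as vectors of length suc (m ∸ 1) = m):
-- K_v (v odd) or K_v minus some 1-factor (v even) has a 2-factorization into
-- exactly α C_m-factors and β C_n-factors.
HWP : (v m n α β : ℕ) → Set
HWP v m n α β =
  3 ≤ m × 3 ≤ n ×
  ((v % 2 ≡ 1 × TwoFactorization (K v) (m ∸ 1) (n ∸ 1) α β) ⊎
   (v % 2 ≡ 0 × Σ (OneFactor v) λ M → TwoFactorization (KminusF M) (m ∸ 1) (n ∸ 1) α β))

-- The factorization is exhibited explicitly. Its vertices fall into the
-- three classes 0–7, 8–15, 16–23; every triangle meets each class once,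
-- so the five triangle factors use only edges between classes, and the six
-- square factors take the remaining edges of K₂₄ minus the 1-factor
-- {2i, 2i+1}. That no edge lies in two factors is witnessed by a colouring
-- of the edges by factors in which every factor's edges get its own colour.
module Submission where

open import Defs
open import Data.Nat using (ℕ; s≤s; z≤n)
open import Data.Fin using (Fin; #_)
open import Data.Fin.Properties using (_≟_; all?; any?; ≤-decTotalOrder)
open import Data.Vec using (Vec; []; _∷_; lookup; toList)
open import Data.List using (List; []; _∷_; concatMap; allFin)
import Data.List.Relation.Unary.All as All
open All using (All)
import Data.List.Relation.Unary.Any as Any
open import Data.List.Membership.Propositional using (find; lose)
open import Data.List.Membership.DecPropositional using (_∈?_)
open import Data.List.Relation.Binary.Permutation.Propositional
  using (_↭_; ↭-sym; module PermutationReasoning)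
import Data.List.Sort.InsertionSort.Base as InsertionSort
import Data.List.Sort.InsertionSort.Properties as InsertionSortProperties
open import Data.Product using (_×_; _,_; proj₁; proj₂)
import Data.Product.Properties as Product
open import Data.Sum using (_⊎_; inj₁; inj₂)
import Data.Sum.Properties as Sum
open import Relation.Binary.Definitions using (Decidable)
open import Relation.Binary.PropositionalEquality using (_≡_; refl; sym; trans)
open import Relation.Nullary using (Dec; ¬?)
open import Relation.Nullary.Decidable using (True; toWitness; map′; _×-dec_; _⊎-dec_; _→-dec_)

-- Insertion sort, unlike the merge sort of Data.List.Sort, reduces during
-- type checking, so sorted lists of concrete vertices compare by refl.
open module FinSort (v : ℕ) = InsertionSort (≤-decTotalOrder v) using (sort)
open module FinSortProperties (v : ℕ) = InsertionSortProperties (≤-decTotalOrder v) using (sort-↭)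

↭-from-sort : ∀ {v} {xs ys : List (Fin v)} → sort v xs ≡ sort v ys → xs ↭ ys
↭-from-sort {v} {xs} {ys} sorted-equal = begin
  xs        ↭⟨ ↭-sym (sort-↭ v xs) ⟩
  sort v xs ≡⟨ sorted-equal ⟩
  sort v ys ↭⟨ sort-↭ v ys ⟩
  ys        ∎
  where open PermutationReasoning

cFactor : ∀ {v k} (cs : List (Cycle v k)) →
          sort v (concatMap toList cs) ≡ sort v (allFin v) → CFactor v k
cFactor cs sorted-equal = record { cycles = cs ; spanning = ↭-from-sort sorted-equal }

all⊎? : ∀ {α β p} {P : Fin α ⊎ Fin β → Set p} → (∀ f → Dec (P f)) → Dec (∀ f → P f)
all⊎? P? = map′ (λ { (on₁ , on₂) (inj₁ i) → on₁ i ; (on₁ , on₂) (inj₂ j) → on₂ j })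
                (λ onAll → (λ i → onAll (inj₁ i)) , (λ j → onAll (inj₂ j)))
                (all? (λ i → P? (inj₁ i)) ×-dec all? (λ j → P? (inj₂ j)))

module _ {v : ℕ} where

  cycleEdge? : ∀ {k} (c : Cycle v k) → Decidable (CycleEdge c)
  cycleEdge? c x y = any? λ i →
    (lookup c i ≟ x ×-dec lookup c (next i) ≟ y) ⊎-dec
    (lookup c i ≟ y ×-dec lookup c (next i) ≟ x)

  factorEdge? : ∀ {k} (F : CFactor v k) → Decidable (FactorEdge F)
  factorEdge? F x y = map′ find (λ (c , c∈F , edge) → lose c∈F edge)
    (Any.any? (λ c → cycleEdge? c x y) (CFactor.cycles F))

  matched? : (M : OneFactor v) → Decidable (Matched M)
  matched? M x y = (x , y) ∈ OneFactor.pairs M ⊎-dec (y , x) ∈ OneFactor.pairs M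
    where _∈_ = _∈?_ (Product.≡-dec _≟_ _≟_)

  kMinusF? : (M : OneFactor v) → Decidable (KminusF M)
  kMinusF? M x y = ¬? (x ≟ y) ×-dec ¬? (matched? M x y)

  EdgesWithin : ∀ {k} → Graph v → CFactor v k → Set
  EdgesWithin Q F = All (λ c → ∀ i → Q (lookup c i) (lookup c (next i)) ×
                                      Q (lookup c (next i)) (lookup c i))
                        (CFactor.cycles F)

  edgesWithin? : ∀ {k} {Q : Graph v} → Decidable Q → (F : CFactor v k) → Dec (EdgesWithin Q F)
  edgesWithin? Q? F = All.all? (λ c → all? λ i → Q? _ _ ×-dec Q? _ _) (CFactor.cycles F)

  factorEdge⇒ : ∀ {k} {Q : Graph v} {F : CFactor v k} → EdgesWithin Q F →
                ∀ {x y} → FactorEdge F x y → Q x y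
  factorEdge⇒ within (c , c∈F , i , inj₁ (refl , refl)) = proj₁ (All.lookup within c∈F i)
  factorEdge⇒ within (c , c∈F , i , inj₂ (refl , refl)) = proj₂ (All.lookup within c∈F i)

module _ {v m' n' α β : ℕ} (A : Fin α → CFactor v m') (B : Fin β → CFactor v n')
         {G : Graph v} (G? : Decidable G) (colour : Fin v → Fin v → Fin α ⊎ Fin β) where

  edgeOf? : ∀ f → Decidable (EdgeOf A B f)
  edgeOf? (inj₁ i) = factorEdge? (A i)
  edgeOf? (inj₂ j) = factorEdge? (B j)

  EdgesOfWithin : Fin α ⊎ Fin β → Graph v → Set
  EdgesOfWithin (inj₁ i) Q = EdgesWithin Q (A i)
  EdgesOfWithin (inj₂ j) Q = EdgesWithin Q (B j)

  edgesOfWithin? : ∀ f {Q} → Decidable Q → Dec (EdgesOfWithin f Q)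
  edgesOfWithin? (inj₁ i) Q? = edgesWithin? Q? (A i)
  edgesOfWithin? (inj₂ j) Q? = edgesWithin? Q? (B j)

  edgeOf⇒ : ∀ f {Q} → EdgesOfWithin f Q → ∀ {x y} → EdgeOf A B f x y → Q x y
  edgeOf⇒ (inj₁ i) {Q} = factorEdge⇒ {Q = Q} {F = A i}
  edgeOf⇒ (inj₂ j) {Q} = factorEdge⇒ {Q = Q} {F = B j}

  ColouredBy : Fin α ⊎ Fin β → Graph v
  ColouredBy f x y = colour x y ≡ f

  sound? : Dec (∀ f → EdgesOfWithin f G)
  sound? = all⊎? λ f → edgesOfWithin? f G?

  colouring? : Dec (∀ f → EdgesOfWithin f (ColouredBy f))
  colouring? = all⊎? λ f → edgesOfWithin? f λ x y → Sum.≡-dec _≟_ _≟_ (colour x y) f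

  covering? : Dec (∀ x y → G x y → EdgeOf A B (colour x y) x y)
  covering? = all? λ x → all? λ y → G? x y →-dec edgeOf? (colour x y) x y

  twoFactorization : {True sound?} → {True colouring?} → {True covering?} →
                     TwoFactorization G m' n' α β
  twoFactorization {sound} {colouring} {covering} = record
    { mFactors = A
    ; nFactors = B
    ; sound    = λ f x y → edgeOf⇒ f (toWitness sound f)
    ; covering = λ x y xy∈G → colour x y , toWitness covering x y xy∈G
    ; unique   = λ f g x y f∋xy g∋xy →
        trans (sym (edgeOf⇒ f (toWitness colouring f) f∋xy))
              (edgeOf⇒ g (toWitness colouring g) g∋xy)
    }

triangleFactors : Vec (CFactor 24 2) 5
triangleFactors =
    cFactor
        ( (# 0 ∷ # 14 ∷ # 16 ∷ []) ∷ (# 1 ∷ # 15 ∷ # 17 ∷ []) ∷ (# 2 ∷ # 12 ∷ # 18 ∷ []) ∷ (# 3 ∷ # 13 ∷ # 19 ∷ [])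
        ∷ (# 4 ∷ # 10 ∷ # 20 ∷ []) ∷ (# 5 ∷ # 11 ∷ # 21 ∷ []) ∷ (# 6 ∷ # 8 ∷ # 22 ∷ []) ∷ (# 7 ∷ # 9 ∷ # 23 ∷ []) ∷ []) refl
  ∷ cFactor
        ( (# 0 ∷ # 8 ∷ # 17 ∷ []) ∷ (# 1 ∷ # 9 ∷ # 16 ∷ []) ∷ (# 2 ∷ # 10 ∷ # 19 ∷ []) ∷ (# 3 ∷ # 11 ∷ # 18 ∷ [])
        ∷ (# 4 ∷ # 12 ∷ # 21 ∷ []) ∷ (# 5 ∷ # 13 ∷ # 20 ∷ []) ∷ (# 6 ∷ # 14 ∷ # 23 ∷ []) ∷ (# 7 ∷ # 15 ∷ # 22 ∷ []) ∷ []) refl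
  ∷ cFactor
        ( (# 0 ∷ # 9 ∷ # 22 ∷ []) ∷ (# 1 ∷ # 8 ∷ # 23 ∷ []) ∷ (# 2 ∷ # 11 ∷ # 20 ∷ []) ∷ (# 3 ∷ # 10 ∷ # 21 ∷ [])
        ∷ (# 4 ∷ # 13 ∷ # 18 ∷ []) ∷ (# 5 ∷ # 12 ∷ # 19 ∷ []) ∷ (# 6 ∷ # 15 ∷ # 16 ∷ []) ∷ (# 7 ∷ # 14 ∷ # 17 ∷ []) ∷ []) refl
  ∷ cFactor
        ( (# 0 ∷ # 15 ∷ # 19 ∷ []) ∷ (# 1 ∷ # 14 ∷ # 18 ∷ []) ∷ (# 2 ∷ # 13 ∷ # 17 ∷ []) ∷ (# 3 ∷ # 12 ∷ # 16 ∷ [])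
        ∷ (# 4 ∷ # 11 ∷ # 23 ∷ []) ∷ (# 5 ∷ # 10 ∷ # 22 ∷ []) ∷ (# 6 ∷ # 9 ∷ # 21 ∷ []) ∷ (# 7 ∷ # 8 ∷ # 20 ∷ []) ∷ []) refl
  ∷ cFactor
        ( (# 0 ∷ # 12 ∷ # 20 ∷ []) ∷ (# 1 ∷ # 13 ∷ # 21 ∷ []) ∷ (# 2 ∷ # 14 ∷ # 22 ∷ []) ∷ (# 3 ∷ # 15 ∷ # 23 ∷ [])
        ∷ (# 4 ∷ # 8 ∷ # 16 ∷ []) ∷ (# 5 ∷ # 9 ∷ # 17 ∷ []) ∷ (# 6 ∷ # 10 ∷ # 18 ∷ []) ∷ (# 7 ∷ # 11 ∷ # 19 ∷ []) ∷ []) refl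
  ∷ []

squareFactors : Vec (CFactor 24 3) 6
squareFactors =
    cFactor
        ( (# 0 ∷ # 2 ∷ # 6 ∷ # 4 ∷ []) ∷ (# 1 ∷ # 3 ∷ # 7 ∷ # 5 ∷ []) ∷ (# 8 ∷ # 13 ∷ # 23 ∷ # 18 ∷ [])
        ∷ (# 9 ∷ # 12 ∷ # 22 ∷ # 19 ∷ []) ∷ (# 10 ∷ # 15 ∷ # 21 ∷ # 16 ∷ []) ∷ (# 11 ∷ # 14 ∷ # 20 ∷ # 17 ∷ []) ∷ []) refl
  ∷ cFactor
        ( (# 0 ∷ # 5 ∷ # 2 ∷ # 7 ∷ []) ∷ (# 1 ∷ # 4 ∷ # 3 ∷ # 6 ∷ []) ∷ (# 8 ∷ # 19 ∷ # 14 ∷ # 21 ∷ [])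
        ∷ (# 9 ∷ # 18 ∷ # 15 ∷ # 20 ∷ []) ∷ (# 10 ∷ # 17 ∷ # 12 ∷ # 23 ∷ []) ∷ (# 11 ∷ # 16 ∷ # 13 ∷ # 22 ∷ []) ∷ []) refl
  ∷ cFactor
        ( (# 0 ∷ # 21 ∷ # 2 ∷ # 23 ∷ []) ∷ (# 1 ∷ # 20 ∷ # 3 ∷ # 22 ∷ []) ∷ (# 4 ∷ # 17 ∷ # 6 ∷ # 19 ∷ [])
        ∷ (# 5 ∷ # 16 ∷ # 7 ∷ # 18 ∷ []) ∷ (# 8 ∷ # 12 ∷ # 11 ∷ # 15 ∷ []) ∷ (# 9 ∷ # 13 ∷ # 10 ∷ # 14 ∷ []) ∷ []) refl
  ∷ cFactor
        ( (# 0 ∷ # 10 ∷ # 7 ∷ # 13 ∷ []) ∷ (# 1 ∷ # 11 ∷ # 6 ∷ # 12 ∷ []) ∷ (# 2 ∷ # 8 ∷ # 5 ∷ # 15 ∷ [])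
        ∷ (# 3 ∷ # 9 ∷ # 4 ∷ # 14 ∷ []) ∷ (# 16 ∷ # 22 ∷ # 17 ∷ # 23 ∷ []) ∷ (# 18 ∷ # 20 ∷ # 19 ∷ # 21 ∷ []) ∷ []) refl
  ∷ cFactor
        ( (# 0 ∷ # 3 ∷ # 17 ∷ # 18 ∷ []) ∷ (# 1 ∷ # 2 ∷ # 16 ∷ # 19 ∷ []) ∷ (# 4 ∷ # 7 ∷ # 21 ∷ # 22 ∷ [])
        ∷ (# 5 ∷ # 6 ∷ # 20 ∷ # 23 ∷ []) ∷ (# 8 ∷ # 10 ∷ # 9 ∷ # 11 ∷ []) ∷ (# 12 ∷ # 14 ∷ # 13 ∷ # 15 ∷ []) ∷ []) refl
  ∷ cFactor
        ( (# 0 ∷ # 6 ∷ # 13 ∷ # 11 ∷ []) ∷ (# 1 ∷ # 7 ∷ # 12 ∷ # 10 ∷ []) ∷ (# 2 ∷ # 4 ∷ # 15 ∷ # 9 ∷ [])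
        ∷ (# 3 ∷ # 5 ∷ # 14 ∷ # 8 ∷ []) ∷ (# 16 ∷ # 18 ∷ # 22 ∷ # 20 ∷ []) ∷ (# 17 ∷ # 19 ∷ # 23 ∷ # 21 ∷ []) ∷ []) refl
  ∷ []

consecutivePairs : OneFactor 24
consecutivePairs = record
  { pairs    = (# 0 , # 1) ∷ (# 2 , # 3) ∷ (# 4 , # 5) ∷ (# 6 , # 7) ∷ (# 8 , # 9) ∷ (# 10 , # 11)
             ∷ (# 12 , # 13) ∷ (# 14 , # 15) ∷ (# 16 , # 17) ∷ (# 18 , # 19) ∷ (# 20 , # 21) ∷ (# 22 , # 23) ∷ []
  ; spanning = ↭-from-sort refl
  }

t₀ t₁ t₂ t₃ t₄ s₀ s₁ s₂ s₃ s₄ s₅ : Fin 5 ⊎ Fin 6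
t₀ = inj₁ (# 0)
t₁ = inj₁ (# 1)
t₂ = inj₁ (# 2)
t₃ = inj₁ (# 3)
t₄ = inj₁ (# 4)
s₀ = inj₂ (# 0)
s₁ = inj₂ (# 1)
s₂ = inj₂ (# 2)
s₃ = inj₂ (# 3)
s₄ = inj₂ (# 4)
s₅ = inj₂ (# 5)

-- Entries on the diagonal and on the 1-factor are arbitrary.
colourTable : Vec (Vec (Fin 5 ⊎ Fin 6) 24) 24
colourTable =
    (t₀ ∷ t₀ ∷ s₀ ∷ s₄ ∷ s₀ ∷ s₁ ∷ s₅ ∷ s₁ ∷ t₁ ∷ t₂ ∷ s₃ ∷ s₅ ∷ t₄ ∷ s₃ ∷ t₀ ∷ t₃ ∷ t₀ ∷ t₁ ∷ s₄ ∷ t₃ ∷ t₄ ∷ s₂ ∷ t₂ ∷ s₂ ∷ [])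
  ∷ (t₀ ∷ t₀ ∷ s₄ ∷ s₀ ∷ s₁ ∷ s₀ ∷ s₁ ∷ s₅ ∷ t₂ ∷ t₁ ∷ s₅ ∷ s₃ ∷ s₃ ∷ t₄ ∷ t₃ ∷ t₀ ∷ t₁ ∷ t₀ ∷ t₃ ∷ s₄ ∷ s₂ ∷ t₄ ∷ s₂ ∷ t₂ ∷ [])
  ∷ (s₀ ∷ s₄ ∷ t₀ ∷ t₀ ∷ s₅ ∷ s₁ ∷ s₀ ∷ s₁ ∷ s₃ ∷ s₅ ∷ t₁ ∷ t₂ ∷ t₀ ∷ t₃ ∷ t₄ ∷ s₃ ∷ s₄ ∷ t₃ ∷ t₀ ∷ t₁ ∷ t₂ ∷ s₂ ∷ t₄ ∷ s₂ ∷ [])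
  ∷ (s₄ ∷ s₀ ∷ t₀ ∷ t₀ ∷ s₁ ∷ s₅ ∷ s₁ ∷ s₀ ∷ s₅ ∷ s₃ ∷ t₂ ∷ t₁ ∷ t₃ ∷ t₀ ∷ s₃ ∷ t₄ ∷ t₃ ∷ s₄ ∷ t₁ ∷ t₀ ∷ s₂ ∷ t₂ ∷ s₂ ∷ t₄ ∷ [])
  ∷ (s₀ ∷ s₁ ∷ s₅ ∷ s₁ ∷ t₀ ∷ t₀ ∷ s₀ ∷ s₄ ∷ t₄ ∷ s₃ ∷ t₀ ∷ t₃ ∷ t₁ ∷ t₂ ∷ s₃ ∷ s₅ ∷ t₄ ∷ s₂ ∷ t₂ ∷ s₂ ∷ t₀ ∷ t₁ ∷ s₄ ∷ t₃ ∷ [])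
  ∷ (s₁ ∷ s₀ ∷ s₁ ∷ s₅ ∷ t₀ ∷ t₀ ∷ s₄ ∷ s₀ ∷ s₃ ∷ t₄ ∷ t₃ ∷ t₀ ∷ t₂ ∷ t₁ ∷ s₅ ∷ s₃ ∷ s₂ ∷ t₄ ∷ s₂ ∷ t₂ ∷ t₁ ∷ t₀ ∷ t₃ ∷ s₄ ∷ [])
  ∷ (s₅ ∷ s₁ ∷ s₀ ∷ s₁ ∷ s₀ ∷ s₄ ∷ t₀ ∷ t₀ ∷ t₀ ∷ t₃ ∷ t₄ ∷ s₃ ∷ s₃ ∷ s₅ ∷ t₁ ∷ t₂ ∷ t₂ ∷ s₂ ∷ t₄ ∷ s₂ ∷ s₄ ∷ t₃ ∷ t₀ ∷ t₁ ∷ [])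
  ∷ (s₁ ∷ s₅ ∷ s₁ ∷ s₀ ∷ s₄ ∷ s₀ ∷ t₀ ∷ t₀ ∷ t₃ ∷ t₀ ∷ s₃ ∷ t₄ ∷ s₅ ∷ s₃ ∷ t₂ ∷ t₁ ∷ s₂ ∷ t₂ ∷ s₂ ∷ t₄ ∷ t₃ ∷ s₄ ∷ t₁ ∷ t₀ ∷ [])
  ∷ (t₁ ∷ t₂ ∷ s₃ ∷ s₅ ∷ t₄ ∷ s₃ ∷ t₀ ∷ t₃ ∷ t₀ ∷ t₀ ∷ s₄ ∷ s₄ ∷ s₂ ∷ s₀ ∷ s₅ ∷ s₂ ∷ t₄ ∷ t₁ ∷ s₀ ∷ s₁ ∷ t₃ ∷ s₁ ∷ t₀ ∷ t₂ ∷ [])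
  ∷ (t₂ ∷ t₁ ∷ s₅ ∷ s₃ ∷ s₃ ∷ t₄ ∷ t₃ ∷ t₀ ∷ t₀ ∷ t₀ ∷ s₄ ∷ s₄ ∷ s₀ ∷ s₂ ∷ s₂ ∷ s₅ ∷ t₁ ∷ t₄ ∷ s₁ ∷ s₀ ∷ s₁ ∷ t₃ ∷ t₂ ∷ t₀ ∷ [])
  ∷ (s₃ ∷ s₅ ∷ t₁ ∷ t₂ ∷ t₀ ∷ t₃ ∷ t₄ ∷ s₃ ∷ s₄ ∷ s₄ ∷ t₀ ∷ t₀ ∷ s₅ ∷ s₂ ∷ s₂ ∷ s₀ ∷ s₀ ∷ s₁ ∷ t₄ ∷ t₁ ∷ t₀ ∷ t₂ ∷ t₃ ∷ s₁ ∷ [])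
  ∷ (s₅ ∷ s₃ ∷ t₂ ∷ t₁ ∷ t₃ ∷ t₀ ∷ s₃ ∷ t₄ ∷ s₄ ∷ s₄ ∷ t₀ ∷ t₀ ∷ s₂ ∷ s₅ ∷ s₀ ∷ s₂ ∷ s₁ ∷ s₀ ∷ t₁ ∷ t₄ ∷ t₂ ∷ t₀ ∷ s₁ ∷ t₃ ∷ [])
  ∷ (t₄ ∷ s₃ ∷ t₀ ∷ t₃ ∷ t₁ ∷ t₂ ∷ s₃ ∷ s₅ ∷ s₂ ∷ s₀ ∷ s₅ ∷ s₂ ∷ t₀ ∷ t₀ ∷ s₄ ∷ s₄ ∷ t₃ ∷ s₁ ∷ t₀ ∷ t₂ ∷ t₄ ∷ t₁ ∷ s₀ ∷ s₁ ∷ [])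
  ∷ (s₃ ∷ t₄ ∷ t₃ ∷ t₀ ∷ t₂ ∷ t₁ ∷ s₅ ∷ s₃ ∷ s₀ ∷ s₂ ∷ s₂ ∷ s₅ ∷ t₀ ∷ t₀ ∷ s₄ ∷ s₄ ∷ s₁ ∷ t₃ ∷ t₂ ∷ t₀ ∷ t₁ ∷ t₄ ∷ s₁ ∷ s₀ ∷ [])
  ∷ (t₀ ∷ t₃ ∷ t₄ ∷ s₃ ∷ s₃ ∷ s₅ ∷ t₁ ∷ t₂ ∷ s₅ ∷ s₂ ∷ s₂ ∷ s₀ ∷ s₄ ∷ s₄ ∷ t₀ ∷ t₀ ∷ t₀ ∷ t₂ ∷ t₃ ∷ s₁ ∷ s₀ ∷ s₁ ∷ t₄ ∷ t₁ ∷ [])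
  ∷ (t₃ ∷ t₀ ∷ s₃ ∷ t₄ ∷ s₅ ∷ s₃ ∷ t₂ ∷ t₁ ∷ s₂ ∷ s₅ ∷ s₀ ∷ s₂ ∷ s₄ ∷ s₄ ∷ t₀ ∷ t₀ ∷ t₂ ∷ t₀ ∷ s₁ ∷ t₃ ∷ s₁ ∷ s₀ ∷ t₁ ∷ t₄ ∷ [])
  ∷ (t₀ ∷ t₁ ∷ s₄ ∷ t₃ ∷ t₄ ∷ s₂ ∷ t₂ ∷ s₂ ∷ t₄ ∷ t₁ ∷ s₀ ∷ s₁ ∷ t₃ ∷ s₁ ∷ t₀ ∷ t₂ ∷ t₀ ∷ t₀ ∷ s₅ ∷ s₄ ∷ s₅ ∷ s₀ ∷ s₃ ∷ s₃ ∷ [])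
  ∷ (t₁ ∷ t₀ ∷ t₃ ∷ s₄ ∷ s₂ ∷ t₄ ∷ s₂ ∷ t₂ ∷ t₁ ∷ t₄ ∷ s₁ ∷ s₀ ∷ s₁ ∷ t₃ ∷ t₂ ∷ t₀ ∷ t₀ ∷ t₀ ∷ s₄ ∷ s₅ ∷ s₀ ∷ s₅ ∷ s₃ ∷ s₃ ∷ [])
  ∷ (s₄ ∷ t₃ ∷ t₀ ∷ t₁ ∷ t₂ ∷ s₂ ∷ t₄ ∷ s₂ ∷ s₀ ∷ s₁ ∷ t₄ ∷ t₁ ∷ t₀ ∷ t₂ ∷ t₃ ∷ s₁ ∷ s₅ ∷ s₄ ∷ t₀ ∷ t₀ ∷ s₃ ∷ s₃ ∷ s₅ ∷ s₀ ∷ [])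
  ∷ (t₃ ∷ s₄ ∷ t₁ ∷ t₀ ∷ s₂ ∷ t₂ ∷ s₂ ∷ t₄ ∷ s₁ ∷ s₀ ∷ t₁ ∷ t₄ ∷ t₂ ∷ t₀ ∷ s₁ ∷ t₃ ∷ s₄ ∷ s₅ ∷ t₀ ∷ t₀ ∷ s₃ ∷ s₃ ∷ s₀ ∷ s₅ ∷ [])
  ∷ (t₄ ∷ s₂ ∷ t₂ ∷ s₂ ∷ t₀ ∷ t₁ ∷ s₄ ∷ t₃ ∷ t₃ ∷ s₁ ∷ t₀ ∷ t₂ ∷ t₄ ∷ t₁ ∷ s₀ ∷ s₁ ∷ s₅ ∷ s₀ ∷ s₃ ∷ s₃ ∷ t₀ ∷ t₀ ∷ s₅ ∷ s₄ ∷ [])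
  ∷ (s₂ ∷ t₄ ∷ s₂ ∷ t₂ ∷ t₁ ∷ t₀ ∷ t₃ ∷ s₄ ∷ s₁ ∷ t₃ ∷ t₂ ∷ t₀ ∷ t₁ ∷ t₄ ∷ s₁ ∷ s₀ ∷ s₀ ∷ s₅ ∷ s₃ ∷ s₃ ∷ t₀ ∷ t₀ ∷ s₄ ∷ s₅ ∷ [])
  ∷ (t₂ ∷ s₂ ∷ t₄ ∷ s₂ ∷ s₄ ∷ t₃ ∷ t₀ ∷ t₁ ∷ t₀ ∷ t₂ ∷ t₃ ∷ s₁ ∷ s₀ ∷ s₁ ∷ t₄ ∷ t₁ ∷ s₃ ∷ s₃ ∷ s₅ ∷ s₀ ∷ s₅ ∷ s₄ ∷ t₀ ∷ t₀ ∷ [])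
  ∷ (s₂ ∷ t₂ ∷ s₂ ∷ t₄ ∷ t₃ ∷ s₄ ∷ t₁ ∷ t₀ ∷ t₂ ∷ t₀ ∷ s₁ ∷ t₃ ∷ s₁ ∷ s₀ ∷ t₁ ∷ t₄ ∷ s₃ ∷ s₃ ∷ s₀ ∷ s₅ ∷ s₄ ∷ s₅ ∷ t₀ ∷ t₀ ∷ [])
  ∷ []

lemma3p2 : HWP 24 3 4 5 6
lemma3p2 =
  s≤s (s≤s (s≤s z≤n)) , s≤s (s≤s (s≤s z≤n)) ,
  inj₂ (refl , consecutivePairs ,
        twoFactorization (lookup triangleFactors) (lookup squareFactors)
                         (kMinusF? consecutivePairs) (λ x y → lookup (lookup colourTable x) y))
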